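{- If $G$ is a graph on $n$ vertices and $1 \leq k \leq n$ is an integer, then $\operatorname{dmg}_k(G) \leq \operatorname{capt}_k(G)-1$.
   Context: Cops and Robbers on a finite simple graph $G$: in round $0$ each of $k$ cops and then the robber choose a vertex; in each later round each cop stays or moves along an edge, then the robber does the same; capture occurs when a cop occupies the robber's vertex. $c(G)$ is the cop number. The $k$-capture time $\operatorname{capt}_k(G)$ is the minimum number of rounds needed for $k$ cops to capture a robber who avoids capture as long as possible; $\operatorname{capt}_k(G)=\infty$ if $k<c(G)$ (and $\operatorname{capt}_n(G)=0$). A vertex is damaged if the robber occupies it in a round in which capture does not occur. $\operatorname{dmg}_k(G)$ is the minimum number of vertices damaged over all games with $k$ cops where the robber places and plays to maximize damage. -}

module Defs where

open import Data.Nat using (ℕ; zero; suc; _≤_)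
open import Data.Fin using (Fin)
open import Data.Fin.Subset using (Subset; _∈_; ∣_∣)
open import Data.Product using (Σ; ∃; _×_; _,_; proj₁; proj₂; ∃-syntax)
open import Data.Sum using (_⊎_)
open import Data.List using (List; []; _∷_)
open import Relation.Binary.PropositionalEquality using (_≡_)
open import Relation.Nullary using (¬_)

record Graph (n : ℕ) : Set₁ where
  field
    Adj        : Fin n → Fin n → Set
    Adj-sym    : ∀ {u v} → Adj u v → Adj v u
    Adj-irrefl : ∀ {u} → ¬ Adj u u
open Graph public

module _ {n : ℕ} (G : Graph n) (k : ℕ) where

  Step : Fin n → Fin n → Set
  Step u v = u ≡ v ⊎ Adj G u v

  Config : Set
  Config = Fin k → Fin n

  CopStep : Config → Config → Set
  CopStep C C' = ∀ i → Step (C i) (C' i)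

  Occupied : Config → Fin n → Set
  Occupied C r = ∃[ i ] C i ≡ r

  -- the history of earlier rounds (most recent first): (cop positions, robber position)
  History : Set
  History = List (Config × Fin n)

  -- Cop strategy (full information, may depend on the whole history).
  -- next C r h : the cops' positions in the next round, given the current
  -- cop positions C, robber position r, and earlier rounds h.
  record CopStrategy : Set where
    field
      start      : Config
      next       : Config → Fin n → History → Config
      next-legal : ∀ C r h → CopStep C (next C r h)

  -- Robber strategy (full information).
  -- start C0 : robber's initial vertex, chosen after seeing the cops' placement C0.
  -- next C' C r h : robber's new vertex, after the cops moved from C to C',
  -- robber currently at r, earlier rounds h.
  record RobberStrategy : Set where
    field
      start      : Config → Fin n
      next       : Config → Config → Fin n → History → Fin n
      next-legal : ∀ C' C r h → Step r (next C' C r h)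

  module Play (σ : CopStrategy) (ρ : RobberStrategy) where
    private
      module σ = CopStrategy σ
      module ρ = RobberStrategy ρ

    advance : (Config × Fin n) × History → (Config × Fin n) × History
    advance ((C , r) , h) =
      ((σ.next C r h , ρ.next (σ.next C r h) C r h) , (C , r) ∷ h)

    state : ℕ → (Config × Fin n) × History
    state zero    = ((σ.start , ρ.start σ.start) , [])
    state (suc i) = advance (state i)

    cops : ℕ → Config
    cops i = proj₁ (proj₁ (state i))

    rob : ℕ → Fin n
    rob i = proj₂ (proj₁ (state i))

    -- capture occurs in round j: in round 0 the robber is placed on a cop;
    -- in round i+1 either a cop moves onto the robber, or the robber
    -- (moving) ends on a cop.
    CaughtAt : ℕ → Set
    CaughtAt zero    = Occupied (cops zero) (rob zero)
    CaughtAt (suc i) = Occupied (cops (suc i)) (rob i) ⊎ Occupied (cops (suc i)) (rob (suc i))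

    CapturedWithin : ℕ → Set
    CapturedWithin t = ∃[ j ] (j ≤ t × CaughtAt j)

    Damaged : Fin n → Set
    Damaged v = ∃[ i ] (rob i ≡ v × (∀ j → j ≤ suc i → ¬ CaughtAt j))

    DamageAtMost : ℕ → Set
    DamageAtMost d = ∃[ S ] (∣ S ∣ ≤ d × (∀ v → Damaged v → v ∈ S))

  CaptWithin : ℕ → Set
  CaptWithin t = Σ CopStrategy λ σ → ∀ ρ → Play.CapturedWithin σ ρ t

  -- capt_k(G) = t  (finite); capt_k(G) = ∞ iff no t satisfies this
  IsCapt : ℕ → Set
  IsCapt t = CaptWithin t × (∀ t' → CaptWithin t' → t ≤ t')

  DmgWithin : ℕ → Set
  DmgWithin d = Σ CopStrategy λ σ → ∀ ρ → Play.DamageAtMost σ ρ d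

  IsDmg : ℕ → Set
  IsDmg d = DmgWithin d × (∀ d' → DmgWithin d' → d ≤ d')

-- A cop strategy that captures within t rounds also keeps the damage to at
-- most t − 1 vertices: a vertex the robber occupies at the end of round i is
-- damaged only if no capture occurs by round i + 1 ≤ t, so only the robber's
-- positions in rounds 0, …, t − 2 can be damaged.

module Submission where

open import Defs
open import Data.Nat using (ℕ; zero; suc; _+_; _≤_; _<_; _∸_; z≤n; s≤s)
open import Data.Nat.Properties
  using (≤-trans; ≤-reflexive; n≤1+n; +-suc; +-monoʳ-≤; m≤n⇒m<n∨m≡n; _≤?_; ≰⇒>; ∸-monoˡ-≤)
open import Data.Bool using (true; false)
open import Data.Fin using (Fin)
open import Data.Vec using (_∷_; [])
open import Data.Fin.Subset using (Subset; ⊥; ⁅_⁆; _∪_; ∣_∣; _∈_)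
open import Data.Fin.Subset.Properties using (∣⊥∣≡0; ∣⁅x⁆∣≡1; x∈⁅x⁆; x∈p∪q⁺)
open import Data.Product using (_,_; ∃-syntax; _×_)
open import Data.Sum using (inj₁; inj₂)
open import Relation.Binary.PropositionalEquality using (_≡_; refl; sym)
open import Relation.Nullary using (yes; no)
open import Data.Empty using (⊥-elim)

∣p∪q∣≤∣p∣+∣q∣ : ∀ {n} (p q : Subset n) → ∣ p ∪ q ∣ ≤ ∣ p ∣ + ∣ q ∣
∣p∪q∣≤∣p∣+∣q∣ []          []          = z≤n
∣p∪q∣≤∣p∣+∣q∣ (true ∷ p)  (true ∷ q)  =
  s≤s (≤-trans (∣p∪q∣≤∣p∣+∣q∣ p q) (+-monoʳ-≤ ∣ p ∣ (n≤1+n ∣ q ∣)))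
∣p∪q∣≤∣p∣+∣q∣ (true ∷ p)  (false ∷ q) = s≤s (∣p∪q∣≤∣p∣+∣q∣ p q)
∣p∪q∣≤∣p∣+∣q∣ (false ∷ p) (true ∷ q)  =
  ≤-trans (s≤s (∣p∪q∣≤∣p∣+∣q∣ p q)) (≤-reflexive (sym (+-suc ∣ p ∣ ∣ q ∣)))
∣p∪q∣≤∣p∣+∣q∣ (false ∷ p) (false ∷ q) = ∣p∪q∣≤∣p∣+∣q∣ p q

module _ {n : ℕ} (f : ℕ → Fin n) where

  firstValues : ℕ → Subset n
  firstValues zero    = ⊥
  firstValues (suc m) = ⁅ f m ⁆ ∪ firstValues m

  ∣firstValues∣≤ : ∀ m → ∣ firstValues m ∣ ≤ m
  ∣firstValues∣≤ zero    = ≤-reflexive (∣⊥∣≡0 n)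
  ∣firstValues∣≤ (suc m) with ∣p∪q∣≤∣p∣+∣q∣ ⁅ f m ⁆ (firstValues m)
  ... | bound rewrite ∣⁅x⁆∣≡1 (f m) = ≤-trans bound (s≤s (∣firstValues∣≤ m))

  f<-∈firstValues : ∀ {m i} → i < m → f i ∈ firstValues m
  f<-∈firstValues {suc m} (s≤s i≤m) with m≤n⇒m<n∨m≡n i≤m
  ... | inj₁ i<m  = x∈p∪q⁺ (inj₂ (f<-∈firstValues i<m))
  ... | inj₂ refl = x∈p∪q⁺ (inj₁ (x∈⁅x⁆ (f m)))

module _ {n : ℕ} {G : Graph n} {k : ℕ} {σ : CopStrategy G k} {ρ : RobberStrategy G k} where
  open Play G k σ ρ

  damaged⇒robbedBefore : ∀ {t v} → CapturedWithin t → Damaged v → ∃[ i ] (i < t ∸ 1 × rob i ≡ v)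
  damaged⇒robbedBefore (j , j≤t , caught) (i , robᵢ≡v , uncaught) with j ≤? suc i
  ... | yes j≤1+i = ⊥-elim (uncaught j j≤1+i caught)
  ... | no  j≰1+i = i , ∸-monoˡ-≤ 1 (≤-trans (≰⇒> j≰1+i) j≤t) , robᵢ≡v

  capturedWithin⇒damageAtMost : ∀ {t} → CapturedWithin t → DamageAtMost (t ∸ 1)
  capturedWithin⇒damageAtMost {t} captured =
    firstValues rob (t ∸ 1) , ∣firstValues∣≤ rob (t ∸ 1) , damaged∈
    where
    damaged∈ : ∀ v → Damaged v → v ∈ firstValues rob (t ∸ 1)
    damaged∈ v damaged with damaged⇒robbedBefore captured damaged
    ... | i , i<t∸1 , refl = f<-∈firstValues rob i<t∸1

captWithin⇒dmgWithin : ∀ {n} {G : Graph n} {k t} → CaptWithin G k t → DmgWithin G k (t ∸ 1)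
captWithin⇒dmgWithin (σ , captures) = σ , λ ρ → capturedWithin⇒damageAtMost (captures ρ)

lemma2p3 : {n : ℕ} (G : Graph n) (k : ℕ) → 1 ≤ k → k ≤ n →
    (t d : ℕ) → IsCapt G k t → IsDmg G k d → d ≤ t ∸ 1
lemma2p3 G k _ _ t d (captWithinT , _) (_ , dmgMinimal) =
  dmgMinimal (t ∸ 1) (captWithin⇒dmgWithin captWithinT)
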